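{- Let $X=\{0,1\}$ and $c\geq 1$. Let $\widetilde{K}_{1,00}(c)$ be the set of words $w\in X^c$ such that the sequence $(1,00,w)$ is not a code, and let $J_{1,00}(c)$ be the set of words $w\in X^c$ of the form $1^{i_1}(00)^{j_1}\cdots 1^{i_k}(00)^{j_k}$ for some $k\geq 1$ and integers $i_l,j_l\geq 0$. Then $\widetilde{K}_{1,00}(c)=J_{1,00}(c)\cup\{0^c\}$, and $$|\widetilde{K}_{1,00}(c)|=F_{c+1}+(c)_2,$$ where $F_n=\frac{(1+\sqrt5)^n-(1-\sqrt5)^n}{2^n\sqrt5}$ is the $n$-th Fibonacci number and $(c)_2\in\{0,1\}$ is the remainder of $c$ modulo $2$.
   Context: A code over $X$ is a finite sequence $(u_1,\ldots,u_m)$ of words over $X$ such that every word $w$ over $X$ has at most one factorization into its terms: if $w=u_{i_1}\cdots u_{i_l}=u_{j_1}\cdots u_{j_{l'}}$ with $l,l'\geq 1$, then $l=l'$ and $i_t=j_t$ for all $t$. -}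

module Defs where

open import Data.Bool using (Bool; true; false)
open import Data.Nat using (ℕ; zero; suc; _+_)
open import Data.Fin using (Fin)
open import Data.List using (List; []; _∷_; _++_; concat; map; length; lookup; replicate)
open import Data.Product using (_×_; _,_; ∃-syntax)
open import Relation.Nullary using (¬_)
open import Relation.Binary.PropositionalEquality using (_≡_; _≢_)

X : Set
X = Bool

𝟘 𝟙 : X
𝟘 = false
𝟙 = true

Word : Set
Word = List X

-- A factorization is a nonempty list
-- of indices (i₁,…,iₗ); two factorizations of the same word must be equal
-- (equal lists of indices means l = l' and iₜ = jₜ for all t).
IsCode : List Word → Set
IsCode us =
  (is js : List (Fin (length us))) → is ≢ [] → js ≢ [] →
  concat (map (lookup us) is) ≡ concat (map (lookup us) js) → is ≡ js

K̃₁₀₀ : ℕ → Word → Set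
K̃₁₀₀ c w = length w ≡ c × ¬ IsCode ((𝟙 ∷ []) ∷ (𝟘 ∷ 𝟘 ∷ []) ∷ w ∷ [])

block : ℕ × ℕ → Word
block (i , j) = replicate i 𝟙 ++ concat (replicate j (𝟘 ∷ 𝟘 ∷ []))

J₁₀₀ : ℕ → Word → Set
J₁₀₀ c w = length w ≡ c ×
  ∃[ ps ] (ps ≢ [] × w ≡ concat (map block ps))

-- Fibonacci numbers: F₀ = 0, F₁ = 1, F_{n+2} = F_{n+1} + F_n (agrees with Binet).
fib : ℕ → ℕ
fib zero = zero
fib (suc zero) = suc zero
fib (suc (suc n)) = fib (suc n) + fib n

-- Call T = {1,00}* the words tiled by 1 and 00.  A nonempty w ∈ T has two factorizations,
-- w itself and its tiling, and 0ᶜ·0ᶜ = (00)ᶜ.  Any other w, tiled greedily from the left, gets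
-- stuck either at a factor 01 or at a final 0.  In the first case the position at which greedy
-- tiling of a product of 1, 00 and w gets stuck separates products starting with w from those
-- starting with 1 or 00, so (1, 00, w) is a code.  In the second case, unless w = 0ᶜ, the
-- reversal of w is in the first case, and since 1 and 00 are palindromes reversal preserves
-- codes.  Finally, the words of T of length c obey the Fibonacci recursion, and 0ᶜ ∈ T iff c
-- is even.
module Submission where

open import Defs
open import Data.Nat using (ℕ; suc; _+_; _≤_; _%_)
open import Data.List using (List; length; replicate)
open import Data.List.Membership.Propositional using (_∈_)
open import Data.List.Relation.Unary.Unique.Propositional using (Unique)
open import Data.Product using (_×_; ∃-syntax)
open import Data.Sum using (_⊎_)
open import Function.Bundles using (_⇔_)
open import Relation.Binary.PropositionalEquality using (_≡_)

open import Data.Bool using (true; false)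
open import Data.Empty using (⊥-elim)
open import Data.Fin using (Fin; zero; suc)
open import Data.List using ([]; _∷_; [_]; _++_; _∷ʳ_; _ʳ++_; concat; map; lookup; reverse)
open import Data.List.Properties
  using ( ∷-injectiveʳ; ++-cancelˡ; ++-identityʳ; concat-++; map-∘; map-cong; length-++
        ; length-map; length-replicate; reverse-++; reverse-map
        ; reverse-involutive; reverse-injective; unfold-reverse)
open import Data.List.Membership.Propositional.Properties
  using (∈-map⁺; ∈-map⁻; ∈-++⁺ˡ; ∈-++⁺ʳ; ∈-++⁻)
open import Data.List.Relation.Unary.Any using (here)
open import Data.List.Relation.Unary.All using ([])
open import Data.List.Relation.Unary.AllPairs using ([]; _∷_)
import Data.List.Relation.Unary.Unique.Propositional.Properties as Unique
open import Data.Maybe using (Maybe; just; nothing)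
import Data.Maybe as Maybe
open import Data.Maybe.Relation.Unary.All using (All; just; nothing)
open import Data.Maybe.Relation.Unary.All.Properties using (gmap)
open import Data.Nat using (zero; z<s)
open import Data.Nat.Properties using (≤-refl; m≤n⇒m≤o+n; m<n+m; <⇒≱)
open import Data.Product using (_,_; proj₂)
open import Data.Sum using (inj₁; inj₂)
import Data.Sum as Sum
open import Function using (_∘_; case_of_)
open import Function.Bundles using (mk⇔; Equivalence)
open import Function.Definitions using (Injective)
import Function.Properties.Equivalence as ⇔
open import Relation.Nullary using (¬_)
open import Relation.Binary.PropositionalEquality
  using (refl; sym; trans; cong; cong₂; subst; _≢_; module ≡-Reasoning)

private
  variable
    k n : ℕ
    w t : Word

us₁₀₀ : Word → List Word
us₁₀₀ w = (𝟙 ∷ []) ∷ (𝟘 ∷ 𝟘 ∷ []) ∷ w ∷ []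

pattern ι₁  = zero
pattern ι₀₀ = suc zero
pattern ιw  = suc (suc zero)

𝟘𝟘++_ : Word → Word
𝟘𝟘++ w = 𝟘 ∷ 𝟘 ∷ w

glue : Word → List (Fin 3) → Word
glue w = concat ∘ map (lookup (us₁₀₀ w))

injective⇒isCode : Injective _≡_ _≡_ (glue w) → IsCode (us₁₀₀ w)
injective⇒isCode inj _ _ _ _ = inj

replicate-++-∷ : ∀ {A : Set} n (x : A) ys → replicate n x ++ x ∷ ys ≡ x ∷ replicate n x ++ ys
replicate-++-∷ zero    x ys = refl
replicate-++-∷ (suc n) x ys = cong (x ∷_) (replicate-++-∷ n x ys)

reverse-replicate : ∀ {A : Set} n (x : A) → reverse (replicate n x) ≡ replicate n x
reverse-replicate zero    x = refl
reverse-replicate (suc n) x = begin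
  reverse (x ∷ replicate n x)      ≡⟨ unfold-reverse x (replicate n x) ⟩
  reverse (replicate n x) ∷ʳ x     ≡⟨ cong (_∷ʳ x) (reverse-replicate n x) ⟩
  replicate n x ++ x ∷ []          ≡⟨ replicate-++-∷ n x [] ⟩
  x ∷ replicate n x ++ []          ≡⟨ cong (x ∷_) (++-identityʳ _) ⟩
  x ∷ replicate n x                ∎
  where open ≡-Reasoning

reverse-concat : ∀ {A : Set} (xss : List (List A)) →
                 reverse (concat xss) ≡ concat (reverse (map reverse xss))
reverse-concat []         = refl
reverse-concat (xs ∷ xss) = begin
  reverse (xs ++ concat xss)
    ≡⟨ reverse-++ xs (concat xss) ⟩
  reverse (concat xss) ++ reverse xs
    ≡⟨ cong₂ _++_ (reverse-concat xss) (sym (++-identityʳ (reverse xs))) ⟩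
  concat (reverse (map reverse xss)) ++ concat [ reverse xs ]
    ≡⟨ concat-++ (reverse (map reverse xss)) _ ⟩
  concat (reverse (map reverse xss) ∷ʳ reverse xs)
    ≡⟨ cong concat (sym (unfold-reverse (reverse xs) (map reverse xss))) ⟩
  concat (reverse (map reverse (xs ∷ xss)))
    ∎
  where open ≡-Reasoning

data Tiled : Word → Set where
  []   : Tiled []
  𝟙∷_  : Tiled w → Tiled (𝟙 ∷ w)
  𝟘𝟘∷_ : Tiled w → Tiled (𝟘 ∷ 𝟘 ∷ w)

-- StuckAt k w: w = p 01 r with p tiled and k = length p.
data StuckAt : ℕ → Word → Set where
  𝟘𝟙∷_ : ∀ r → StuckAt 0 (𝟘 ∷ 𝟙 ∷ r)
  𝟙∷_  : StuckAt k w → StuckAt (1 + k) (𝟙 ∷ w)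
  𝟘𝟘∷_ : StuckAt k w → StuckAt (2 + k) (𝟘 ∷ 𝟘 ∷ w)

data Shape : Word → Set where
  tiled    : Tiled w → Shape w
  stuck    : StuckAt k w → Shape w
  dangling : Tiled w → Shape (w ∷ʳ 𝟘)

shape : ∀ w → Shape w
shape []                 = tiled []
shape (false ∷ [])       = dangling []
shape (false ∷ true ∷ r) = stuck (𝟘𝟙∷ r)
shape (true ∷ w) with shape w
... | tiled t    = tiled (𝟙∷ t)
... | stuck s    = stuck (𝟙∷ s)
... | dangling t = dangling (𝟙∷ t)
shape (false ∷ false ∷ w) with shape w
... | tiled t    = tiled (𝟘𝟘∷ t)
... | stuck s    = stuck (𝟘𝟘∷ s)
... | dangling t = dangling (𝟘𝟘∷ t)

tiled-++ : ∀ {u} → Tiled u → Tiled w → Tiled (u ++ w)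
tiled-++ []      q = q
tiled-++ (𝟙∷ p)  q = 𝟙∷ tiled-++ p q
tiled-++ (𝟘𝟘∷ p) q = 𝟘𝟘∷ tiled-++ p q

tiled-ʳ++ : ∀ {u} → Tiled u → Tiled w → Tiled (u ʳ++ w)
tiled-ʳ++ []      q = q
tiled-ʳ++ (𝟙∷ p)  q = tiled-ʳ++ p (𝟙∷ q)
tiled-ʳ++ (𝟘𝟘∷ p) q = tiled-ʳ++ p (𝟘𝟘∷ q)

tiled-reverse : Tiled w → Tiled (reverse w)
tiled-reverse p = tiled-ʳ++ p []

stuck-++ : StuckAt k w → StuckAt k (w ++ t)
stuck-++ (𝟘𝟙∷ r) = 𝟘𝟙∷ _
stuck-++ (𝟙∷ s)  = 𝟙∷ stuck-++ s
stuck-++ (𝟘𝟘∷ s) = 𝟘𝟘∷ stuck-++ s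

stuck-nonempty : StuckAt k w → w ≢ []
stuck-nonempty (𝟘𝟙∷ r) ()
stuck-nonempty (𝟙∷ s)  ()
stuck-nonempty (𝟘𝟘∷ s) ()

𝟘∷-tiled : Tiled w → (∃[ n ] 𝟘 ∷ w ≡ replicate n 𝟘) ⊎ (∃[ k ] StuckAt k (𝟘 ∷ w))
𝟘∷-tiled []      = inj₁ (1 , refl)
𝟘∷-tiled (𝟙∷ p)  = inj₂ (0 , 𝟘𝟙∷ _)
𝟘∷-tiled (𝟘𝟘∷ p) with 𝟘∷-tiled p
... | inj₁ (n , e) = inj₁ (2 + n , cong 𝟘𝟘++_ e)
... | inj₂ (k , s) = inj₂ (2 + k , 𝟘𝟘∷ s)

reverse≡zeros : reverse w ≡ replicate n 𝟘 → w ≡ replicate (length w) 𝟘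
reverse≡zeros {w} {n} e = trans w≡zeros (cong (λ m → replicate m 𝟘) n≡length)
  where
    w≡zeros : w ≡ replicate n 𝟘
    w≡zeros = trans (sym (reverse-involutive w)) (trans (cong reverse e) (reverse-replicate n 𝟘))
    n≡length : n ≡ length w
    n≡length = trans (sym (length-replicate n)) (cong length (sym w≡zeros))

dangling-zeros⊎stuck : Tiled w → (w ∷ʳ 𝟘 ≡ replicate (length (w ∷ʳ 𝟘)) 𝟘)
                                  ⊎ (∃[ k ] StuckAt k (reverse (w ∷ʳ 𝟘)))
dangling-zeros⊎stuck {w} p =
  Sum.map (λ (n , e) → reverse≡zeros (trans reverse-dangling e))
          (λ (k , s) → k , subst (StuckAt k) (sym reverse-dangling) s)
          (𝟘∷-tiled (tiled-reverse p))
  where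
    reverse-dangling : reverse (w ∷ʳ 𝟘) ≡ 𝟘 ∷ reverse w
    reverse-dangling = reverse-++ w (𝟘 ∷ [])

defect : Word → Maybe ℕ
defect []                  = nothing
defect (true ∷ w)          = Maybe.map (1 +_) (defect w)
defect (false ∷ false ∷ w) = Maybe.map (2 +_) (defect w)
defect (false ∷ _)         = just 0

defect-stuck : StuckAt k w → defect w ≡ just k
defect-stuck (𝟘𝟙∷ r) = refl
defect-stuck (𝟙∷ s)  = cong (Maybe.map (1 +_)) (defect-stuck s)
defect-stuck (𝟘𝟘∷ s) = cong (Maybe.map (2 +_)) (defect-stuck s)

shifted-defect≢ : ∀ n {x} → All (k ≤_) x → Maybe.map (suc n +_) x ≢ just k
shifted-defect≢ n nothing        ()
shifted-defect≢ n (just {m} k≤m) refl = <⇒≱ (m<n+m m z<s) k≤m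

module _ {k w} (s : StuckAt k w) where

  defect-glue≥ : ∀ is → All (k ≤_) (defect (glue w is))
  defect-glue≥ []          = nothing
  defect-glue≥ (ι₁ ∷ is)  = gmap (m≤n⇒m≤o+n 1) (defect-glue≥ is)
  defect-glue≥ (ι₀₀ ∷ is) = gmap (m≤n⇒m≤o+n 2) (defect-glue≥ is)
  defect-glue≥ (ιw ∷ is)  = subst (All (k ≤_)) (sym (defect-stuck (stuck-++ s))) (just ≤-refl)

  -- Greedy tiling of a factorization that starts with 1 or 00 gets stuck strictly after k.
  tile-before-w : ∀ n is t → Maybe.map (suc n +_) (defect (glue w is)) ≢ defect (w ++ t)
  tile-before-w n is t e = shifted-defect≢ n (defect-glue≥ is) (trans e (defect-stuck (stuck-++ s)))

  stuck⇒glue-injective : Injective _≡_ _≡_ (glue w)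
  stuck⇒glue-injective {is} {js} = go is js
    where
      go : ∀ is js → glue w is ≡ glue w js → is ≡ js
      go []          []          _ = refl
      go []          (ι₁ ∷ js)  ()
      go []          (ι₀₀ ∷ js) ()
      go []          (ιw ∷ js)  e = ⊥-elim (stuck-nonempty (stuck-++ s) (sym e))
      go (ι₁ ∷ is)  []          ()
      go (ι₀₀ ∷ is) []          ()
      go (ιw ∷ is)  []          e = ⊥-elim (stuck-nonempty (stuck-++ s) e)
      go (ι₁ ∷ is)  (ι₁ ∷ js)  e = cong (ι₁ ∷_) (go is js (∷-injectiveʳ e))
      go (ι₀₀ ∷ is) (ι₀₀ ∷ js) e = cong (ι₀₀ ∷_) (go is js (∷-injectiveʳ (∷-injectiveʳ e)))
      go (ιw ∷ is)  (ιw ∷ js)  e = cong (ιw ∷_) (go is js (++-cancelˡ w _ _ e))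
      go (ι₁ ∷ is)  (ι₀₀ ∷ js) ()
      go (ι₀₀ ∷ is) (ι₁ ∷ js)  ()
      go (ι₁ ∷ is)  (ιw ∷ js)  e = ⊥-elim (tile-before-w 0 is _ (cong defect e))
      go (ι₀₀ ∷ is) (ιw ∷ js)  e = ⊥-elim (tile-before-w 1 is _ (cong defect e))
      go (ιw ∷ is)  (ι₁ ∷ js)  e = ⊥-elim (tile-before-w 0 js _ (cong defect (sym e)))
      go (ιw ∷ is)  (ι₀₀ ∷ js) e = ⊥-elim (tile-before-w 1 js _ (cong defect (sym e)))

lookup-us₁₀₀-reverse : ∀ w i → lookup (us₁₀₀ (reverse w)) i ≡ reverse (lookup (us₁₀₀ w) i)
lookup-us₁₀₀-reverse w ι₁  = refl
lookup-us₁₀₀-reverse w ι₀₀ = refl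
lookup-us₁₀₀-reverse w ιw  = refl

glue-reverse : ∀ w is → glue (reverse w) (reverse is) ≡ reverse (glue w is)
glue-reverse w is = begin
  concat (map (lookup (us₁₀₀ (reverse w))) (reverse is))
    ≡⟨ cong concat (map-cong (lookup-us₁₀₀-reverse w) (reverse is)) ⟩
  concat (map (reverse ∘ lookup (us₁₀₀ w)) (reverse is))
    ≡⟨ cong concat (reverse-map _ is) ⟩
  concat (reverse (map (reverse ∘ lookup (us₁₀₀ w)) is))
    ≡⟨ cong (concat ∘ reverse) (map-∘ is) ⟩
  concat (reverse (map reverse (map (lookup (us₁₀₀ w)) is)))
    ≡⟨ sym (reverse-concat (map (lookup (us₁₀₀ w)) is)) ⟩
  reverse (glue w is)
    ∎
  where open ≡-Reasoning

glue-injective-reverse : Injective _≡_ _≡_ (glue (reverse w)) → Injective _≡_ _≡_ (glue w)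
glue-injective-reverse {w} inj {is} {js} e = reverse-injective (inj (begin
  glue (reverse w) (reverse is)  ≡⟨ glue-reverse w is ⟩
  reverse (glue w is)            ≡⟨ cong reverse e ⟩
  reverse (glue w js)            ≡⟨ sym (glue-reverse w js) ⟩
  glue (reverse w) (reverse js)  ∎))
  where open ≡-Reasoning

tiling : Tiled w → List (Fin 3)
tiling []      = []
tiling (𝟙∷ p)  = ι₁ ∷ tiling p
tiling (𝟘𝟘∷ p) = ι₀₀ ∷ tiling p

glue-tiling : ∀ v (p : Tiled w) → glue v (tiling p) ≡ w
glue-tiling v []      = refl
glue-tiling v (𝟙∷ p)  = cong (𝟙 ∷_) (glue-tiling v p)
glue-tiling v (𝟘𝟘∷ p) = cong 𝟘𝟘++_ (glue-tiling v p)

tiling≢[ιw] : (p : Tiled w) → tiling p ≢ ιw ∷ []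
tiling≢[ιw] []      ()
tiling≢[ιw] (𝟙∷ p)  ()
tiling≢[ιw] (𝟘𝟘∷ p) ()

tiled⇒¬isCode : Tiled w → w ≢ [] → ¬ IsCode (us₁₀₀ w)
tiled⇒¬isCode {w} p w≢[] code =
  tiling≢[ιw] p (code (tiling p) (ιw ∷ []) tiling≢[] (λ ())
    (trans (glue-tiling w p) (sym (++-identityʳ w))))
  where
    tiling≢[] : tiling p ≢ []
    tiling≢[] e = w≢[] (trans (sym (glue-tiling w p)) (cong (glue w) e))

glue-replicate-ι₀₀ : ∀ v n → glue v (replicate n ι₀₀) ≡ replicate n 𝟘 ++ replicate n 𝟘
glue-replicate-ι₀₀ v zero    = refl
glue-replicate-ι₀₀ v (suc n) =
  cong (𝟘 ∷_) (trans (cong (𝟘 ∷_) (glue-replicate-ι₀₀ v n)) (sym (replicate-++-∷ n 𝟘 _)))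

zeros⇒¬isCode : ∀ n → ¬ IsCode (us₁₀₀ (replicate (suc n) 𝟘))
zeros⇒¬isCode n code =
  case code (ιw ∷ ιw ∷ []) (replicate (suc n) ι₀₀) (λ ()) (λ ()) glue-equal of λ ()
  where
    zeros : Word
    zeros = replicate (suc n) 𝟘
    glue-equal : glue zeros (ιw ∷ ιw ∷ []) ≡ glue zeros (replicate (suc n) ι₀₀)
    glue-equal =
      trans (cong (zeros ++_) (++-identityʳ zeros)) (sym (glue-replicate-ι₀₀ zeros (suc n)))

length≡suc⇒≢[] : ∀ {A : Set} {xs : List A} → length xs ≡ suc n → xs ≢ []
length≡suc⇒≢[] {xs = []}    () _
length≡suc⇒≢[] {xs = _ ∷ _} _  ()

¬isCode⇔ : length w ≡ suc n → (¬ IsCode (us₁₀₀ w)) ⇔ (Tiled w ⊎ w ≡ replicate (suc n) 𝟘)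
¬isCode⇔ {w} {n} len = mk⇔ to from
  where
    to : ¬ IsCode (us₁₀₀ w) → Tiled w ⊎ w ≡ replicate (suc n) 𝟘
    to ¬code with shape w
    ... | tiled p = inj₁ p
    ... | stuck s = ⊥-elim (¬code (injective⇒isCode (stuck⇒glue-injective s)))
    ... | dangling p with dangling-zeros⊎stuck p
    ...   | inj₁ zeros        = inj₂ (subst (λ m → w ≡ replicate m 𝟘) len zeros)
    ...   | inj₂ (_ , s-rev) =
            ⊥-elim (¬code (injective⇒isCode
                             (glue-injective-reverse (stuck⇒glue-injective s-rev))))
    from : Tiled w ⊎ w ≡ replicate (suc n) 𝟘 → ¬ IsCode (us₁₀₀ w)
    from (inj₁ p)    = tiled⇒¬isCode p (length≡suc⇒≢[] len)
    from (inj₂ refl) = zeros⇒¬isCode n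

tiled-replicate-𝟙 : ∀ i → Tiled (replicate i 𝟙)
tiled-replicate-𝟙 zero    = []
tiled-replicate-𝟙 (suc i) = 𝟙∷ tiled-replicate-𝟙 i

tiled-replicate-𝟘𝟘 : ∀ j → Tiled (concat (replicate j (𝟘 ∷ 𝟘 ∷ [])))
tiled-replicate-𝟘𝟘 zero    = []
tiled-replicate-𝟘𝟘 (suc j) = 𝟘𝟘∷ tiled-replicate-𝟘𝟘 j

tiled-blocks : ∀ ps → Tiled (concat (map block ps))
tiled-blocks []            = []
tiled-blocks ((i , j) ∷ ps) =
  tiled-++ (tiled-++ (tiled-replicate-𝟙 i) (tiled-replicate-𝟘𝟘 j)) (tiled-blocks ps)

blocks : Tiled w → List (ℕ × ℕ)
blocks []      = [ (0 , 0) ]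
blocks (𝟙∷ p)  = (1 , 0) ∷ blocks p
blocks (𝟘𝟘∷ p) = (0 , 1) ∷ blocks p

blocks≢[] : (p : Tiled w) → blocks p ≢ []
blocks≢[] []      ()
blocks≢[] (𝟙∷ p)  ()
blocks≢[] (𝟘𝟘∷ p) ()

concat-blocks : (p : Tiled w) → w ≡ concat (map block (blocks p))
concat-blocks []      = refl
concat-blocks (𝟙∷ p)  = cong (𝟙 ∷_) (concat-blocks p)
concat-blocks (𝟘𝟘∷ p) = cong 𝟘𝟘++_ (concat-blocks p)

J₁₀₀⇔ : ∀ c w → J₁₀₀ c w ⇔ (length w ≡ c × Tiled w)
J₁₀₀⇔ c w = mk⇔
  (λ { (len , ps , _ , e) → len , subst Tiled (sym e) (tiled-blocks ps) })
  (λ { (len , p) → len , blocks p , blocks≢[] p , concat-blocks p })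

K̃₁₀₀⇔ : ∀ n w → K̃₁₀₀ (suc n) w ⇔ (J₁₀₀ (suc n) w ⊎ w ≡ replicate (suc n) 𝟘)
K̃₁₀₀⇔ n w = mk⇔ to from
  where
    to : K̃₁₀₀ (suc n) w → J₁₀₀ (suc n) w ⊎ w ≡ replicate (suc n) 𝟘
    to (len , ¬code) =
      Sum.map₁ (λ p → Equivalence.from (J₁₀₀⇔ _ w) (len , p))
               (Equivalence.to (¬isCode⇔ len) ¬code)
    from : J₁₀₀ (suc n) w ⊎ w ≡ replicate (suc n) 𝟘 → K̃₁₀₀ (suc n) w
    from (inj₁ j) with Equivalence.to (J₁₀₀⇔ _ w) j
    ... | len , p = len , Equivalence.from (¬isCode⇔ len) (inj₁ p)
    from (inj₂ refl) = length-replicate (suc n) , zeros⇒¬isCode n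

tilings : ℕ → List Word
tilings 0             = [ [] ]
tilings 1             = [ 𝟙 ∷ [] ]
tilings (suc (suc n)) = map (𝟙 ∷_) (tilings (suc n)) ++ map 𝟘𝟘++_ (tilings n)

length-tilings : ∀ n → length (tilings n) ≡ fib (suc n)
length-tilings 0             = refl
length-tilings 1             = refl
length-tilings (suc (suc n)) = begin
  length (map (𝟙 ∷_) (tilings (suc n)) ++ map 𝟘𝟘++_ (tilings n))
    ≡⟨ length-++ (map (𝟙 ∷_) (tilings (suc n))) ⟩
  length (map (𝟙 ∷_) (tilings (suc n))) + length (map 𝟘𝟘++_ (tilings n))
    ≡⟨ cong₂ _+_ (length-map _ (tilings (suc n))) (length-map _ (tilings n)) ⟩
  length (tilings (suc n)) + length (tilings n)
    ≡⟨ cong₂ _+_ (length-tilings (suc n)) (length-tilings n) ⟩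
  fib (suc (suc n)) + fib (suc n)
    ∎
  where open ≡-Reasoning

tilings-unique : ∀ n → Unique (tilings n)
tilings-unique 0             = [] ∷ []
tilings-unique 1             = [] ∷ []
tilings-unique (suc (suc n)) =
  Unique.++⁺ (Unique.map⁺ ∷-injectiveʳ (tilings-unique (suc n)))
             (Unique.map⁺ (∷-injectiveʳ ∘ ∷-injectiveʳ) (tilings-unique n))
             starts-differently
  where
    starts-differently : ∀ {v} → ¬ (v ∈ map (𝟙 ∷_) (tilings (suc n)) × v ∈ map 𝟘𝟘++_ (tilings n))
    starts-differently (v∈₁ , v∈₀₀) with ∈-map⁻ (𝟙 ∷_) v∈₁ | ∈-map⁻ 𝟘𝟘++_ v∈₀₀
    ... | _ , _ , refl | _ , _ , ()

∈-tilings⁻ : ∀ n {v} → v ∈ tilings n → length v ≡ n × Tiled v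
∈-tilings⁻ 0 (here refl) = refl , []
∈-tilings⁻ 1 (here refl) = refl , 𝟙∷ []
∈-tilings⁻ (suc (suc n)) v∈ with ∈-++⁻ (map (𝟙 ∷_) (tilings (suc n))) v∈
... | inj₁ v∈₁ with ∈-map⁻ (𝟙 ∷_) v∈₁
...   | u , u∈ , refl with ∈-tilings⁻ (suc n) u∈
...     | len , p = cong suc len , 𝟙∷ p
∈-tilings⁻ (suc (suc n)) v∈ | inj₂ v∈₀₀ with ∈-map⁻ 𝟘𝟘++_ v∈₀₀
...   | u , u∈ , refl with ∈-tilings⁻ n u∈
...     | len , p = cong (2 +_) len , 𝟘𝟘∷ p

∈-tilings⁺ : Tiled w → w ∈ tilings (length w)
∈-tilings⁺ []                = here refl
∈-tilings⁺ (𝟙∷ [])           = here refl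
∈-tilings⁺ (𝟙∷ p@(𝟙∷ _))     = ∈-++⁺ˡ (∈-map⁺ (𝟙 ∷_) (∈-tilings⁺ p))
∈-tilings⁺ (𝟙∷ p@(𝟘𝟘∷ _))    = ∈-++⁺ˡ (∈-map⁺ (𝟙 ∷_) (∈-tilings⁺ p))
∈-tilings⁺ (𝟘𝟘∷_ {w} p)      =
  ∈-++⁺ʳ (map (𝟙 ∷_) (tilings (suc (length w)))) (∈-map⁺ 𝟘𝟘++_ (∈-tilings⁺ p))

ifOdd : ∀ {A : Set} → ℕ → A → List A
ifOdd 0             x = []
ifOdd 1             x = [ x ]
ifOdd (suc (suc n)) x = ifOdd n x

length-ifOdd : ∀ {A : Set} n (x : A) → length (ifOdd n x) ≡ n % 2
length-ifOdd 0             x = refl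
length-ifOdd 1             x = refl
length-ifOdd (suc (suc n)) x = length-ifOdd n x

ifOdd-unique : ∀ {A : Set} n (x : A) → Unique (ifOdd n x)
ifOdd-unique 0             x = []
ifOdd-unique 1             x = [] ∷ []
ifOdd-unique (suc (suc n)) x = ifOdd-unique n x

∈-ifOdd⁻ : ∀ {A : Set} n {x v : A} → v ∈ ifOdd n x → v ≡ x
∈-ifOdd⁻ 1             (here refl) = refl
∈-ifOdd⁻ (suc (suc n)) v∈          = ∈-ifOdd⁻ n v∈

∈-ifOdd⇒zeros-untiled : ∀ n {x v : Word} → v ∈ ifOdd n x → ¬ Tiled (replicate n 𝟘)
∈-ifOdd⇒zeros-untiled 1             _  ()
∈-ifOdd⇒zeros-untiled (suc (suc n)) v∈ (𝟘𝟘∷ p) = ∈-ifOdd⇒zeros-untiled n v∈ p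

zeros-tiled⊎∈-ifOdd : ∀ n (x : Word) → Tiled (replicate n 𝟘) ⊎ x ∈ ifOdd n x
zeros-tiled⊎∈-ifOdd 0             x = inj₁ []
zeros-tiled⊎∈-ifOdd 1             x = inj₂ (here refl)
zeros-tiled⊎∈-ifOdd (suc (suc n)) x = Sum.map₁ 𝟘𝟘∷_ (zeros-tiled⊎∈-ifOdd n x)

K̃₁₀₀-list : ℕ → List Word
K̃₁₀₀-list c = tilings c ++ ifOdd c (replicate c 𝟘)

∈-K̃₁₀₀-list⇔ : ∀ c w → w ∈ K̃₁₀₀-list c ⇔ (J₁₀₀ c w ⊎ w ≡ replicate c 𝟘)
∈-K̃₁₀₀-list⇔ c w = mk⇔ to from
  where
    to : w ∈ K̃₁₀₀-list c → J₁₀₀ c w ⊎ w ≡ replicate c 𝟘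
    to w∈ = Sum.map (Equivalence.from (J₁₀₀⇔ c w) ∘ ∈-tilings⁻ c) (∈-ifOdd⁻ c)
                    (∈-++⁻ (tilings c) w∈)
    from : J₁₀₀ c w ⊎ w ≡ replicate c 𝟘 → w ∈ K̃₁₀₀-list c
    from (inj₁ j) with Equivalence.to (J₁₀₀⇔ c w) j
    ... | refl , p = ∈-++⁺ˡ (∈-tilings⁺ p)
    from (inj₂ refl) with zeros-tiled⊎∈-ifOdd c (replicate c 𝟘)
    ... | inj₁ p  =
      ∈-++⁺ˡ (subst (λ m → replicate c 𝟘 ∈ tilings m) (length-replicate c) (∈-tilings⁺ p))
    ... | inj₂ z∈ = ∈-++⁺ʳ (tilings c) z∈

K̃₁₀₀-list-unique : ∀ c → Unique (K̃₁₀₀-list c)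
K̃₁₀₀-list-unique c = Unique.++⁺ (tilings-unique c) (ifOdd-unique c _) disjoint
  where
    disjoint : ∀ {v} → ¬ (v ∈ tilings c × v ∈ ifOdd c (replicate c 𝟘))
    disjoint (v∈ , v∈odd) with ∈-ifOdd⁻ c v∈odd
    ... | refl = ∈-ifOdd⇒zeros-untiled c v∈odd (proj₂ (∈-tilings⁻ c v∈))

length-K̃₁₀₀-list : ∀ c → length (K̃₁₀₀-list c) ≡ fib (suc c) + c % 2
length-K̃₁₀₀-list c = trans (length-++ (tilings c)) (cong₂ _+_ (length-tilings c) (length-ifOdd c _))

proposition3 : (c : ℕ) → 1 ≤ c →
    ((w : Word) → K̃₁₀₀ c w ⇔ (J₁₀₀ c w ⊎ w ≡ replicate c 𝟘))
    × (∃[ L ] (Unique L × ((w : Word) → w ∈ L ⇔ K̃₁₀₀ c w)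
                × length L ≡ fib (suc c) + c % 2))
proposition3 zero    ()
proposition3 (suc n) _ =
  K̃₁₀₀⇔ n ,
  K̃₁₀₀-list (suc n) ,
  K̃₁₀₀-list-unique (suc n) ,
  (λ w → ⇔.trans (∈-K̃₁₀₀-list⇔ (suc n) w) (⇔.sym (K̃₁₀₀⇔ n w))) ,
  length-K̃₁₀₀-list (suc n)
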